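{- Let $n\ge 2$ and consider $n$ coins arranged in a circle, each heads-up or tails-up. A move removes a heads-up coin, flips its neighbours on the circle (the coins immediately clockwise and counterclockwise of it; if only two coins are present, the single other coin is flipped once), and then closes the gap so that the remaining coins again form a circle in the same cyclic order; a single remaining coin may be removed if it is heads-up. Such an arrangement is removable (some sequence of moves removes all coins) if and only if it contains at least one heads-up coin and the number of tails-up coins is odd. -}

module Defs where

open import Data.Bool using (Bool; true; false; not)
open import Data.List using (List; []; _∷_; _++_; [_]; length)
open import Data.Nat using (ℕ; zero; suc)

-- A circle of coins is a list of Bools read in clockwise order, the last
-- element being adjacent to the first.  true = heads-up, false = tails-up.
Coins : Set
Coins = List Bool

flipLast : List Bool → List Bool
flipLast []           = []
flipLast (x ∷ [])     = not x ∷ []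
flipLast (x ∷ y ∷ r)  = x ∷ flipLast (y ∷ r)

-- Given the coins remaining after removing the FIRST coin of the circle
-- (in the same cyclic order, starting just clockwise of the removed coin),
-- flip the neighbours of the removed coin:
--   no coin left      : nothing to flip
--   one coin left     : it is flipped once
--   ≥ 2 coins left    : the first (clockwise neighbour) and the last
--                       (counterclockwise neighbour) are flipped
flipNeighbours : List Bool → List Bool
flipNeighbours []            = []
flipNeighbours (a ∷ [])      = not a ∷ []
flipNeighbours (a ∷ b ∷ r)   = not a ∷ flipLast (b ∷ r)

-- Since a circle has no distinguished starting point,
-- 'rotate' lets us relabel the circle (move the first coin to the end); a
-- move removes the (heads-up) first coin and flips its neighbours.
-- Together these allow removing a heads-up coin at any position.
data Removable : Coins → Set where
  done   : Removable []
  rotate : ∀ {x xs} → Removable (xs ++ [ x ]) → Removable (x ∷ xs)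
  move   : ∀ {xs} → Removable (flipNeighbours xs) → Removable (true ∷ xs)

tails : Coins → ℕ
tails []           = zero
tails (true  ∷ xs) = tails xs
tails (false ∷ xs) = suc (tails xs)

{-# OPTIONS --safe #-}
module Submission where

-- As long as at least two coins remain, a move deletes a heads-up coin and flips
-- two coins, so the parity of the number of tails-up coins is preserved; from two
-- coins a move leaves the other coin flipped, which is removable only if it is then
-- heads-up, so the last two coins contain exactly one tails-up coin. Conversely,
-- with a heads-up coin and an odd number of tails-up coins, some heads-up coin has
-- a tails-up clockwise neighbour; removing it turns that neighbour heads-up and
-- flips one more coin, leaving a smaller circle of the same kind.

open import Defs
open import Data.Bool using (true; false; not)
open import Data.List using ([]; _∷_; _++_; [_]; length)
open import Data.List.Properties using (++-assoc; ++-identityʳ; length-++-comm)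
open import Data.List.Membership.Propositional using (_∈_)
open import Data.List.Membership.Propositional.Properties using (∈-∃++)
open import Data.List.Relation.Binary.Permutation.Propositional.Properties using (∈-resp-↭; ++-comm)
open import Data.List.Relation.Unary.Any using (here; there)
open import Data.Nat using (zero; suc; _+_; _≤_; _%_; s≤s; z≤n; parity)
open import Data.Nat.Properties using (+-comm; suc-injective)
open import Data.Parity using (1ℙ; _⁻¹)
open import Data.Parity.Properties using (suc-homo-⁻¹; ⁻¹-selfInverse; ⁻¹-involutive)
open import Data.Product using (_×_; _,_; ∃₂)
open import Function.Bundles using (_⇔_; mk⇔)
open import Relation.Binary.PropositionalEquality using (_≡_; refl; sym; trans; cong; subst; module ≡-Reasoning)

parity-suc : ∀ n → parity (suc n) ≡ parity n ⁻¹
parity-suc n = sym (⁻¹-selfInverse (suc-homo-⁻¹ n))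

parity≡1ℙ⇒%2≡1 : ∀ n → parity n ≡ 1ℙ → n % 2 ≡ 1
parity≡1ℙ⇒%2≡1 1             _ = refl
parity≡1ℙ⇒%2≡1 (suc (suc n)) p = parity≡1ℙ⇒%2≡1 n p

%2≡1⇒parity≡1ℙ : ∀ n → n % 2 ≡ 1 → parity n ≡ 1ℙ
%2≡1⇒parity≡1ℙ 1             _ = refl
%2≡1⇒parity≡1ℙ (suc (suc n)) p = %2≡1⇒parity≡1ℙ n p

tails-++ : ∀ xs ys → tails (xs ++ ys) ≡ tails xs + tails ys
tails-++ []           ys = refl
tails-++ (true  ∷ xs) ys = tails-++ xs ys
tails-++ (false ∷ xs) ys = cong suc (tails-++ xs ys)

tails-++-comm : ∀ xs ys → tails (xs ++ ys) ≡ tails (ys ++ xs)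
tails-++-comm xs ys = begin
  tails (xs ++ ys)      ≡⟨ tails-++ xs ys ⟩
  tails xs + tails ys   ≡⟨ +-comm (tails xs) (tails ys) ⟩
  tails ys + tails xs   ≡⟨ tails-++ ys xs ⟨
  tails (ys ++ xs)      ∎
  where open ≡-Reasoning

odd-tails⇒false∈ : ∀ xs → parity (tails xs) ≡ 1ℙ → false ∈ xs
odd-tails⇒false∈ []           ()
odd-tails⇒false∈ (false ∷ xs) _ = here refl
odd-tails⇒false∈ (true  ∷ xs) p = there (odd-tails⇒false∈ xs p)

length-flipLast : ∀ xs → length (flipLast xs) ≡ length xs
length-flipLast []           = refl
length-flipLast (x ∷ [])     = refl
length-flipLast (x ∷ y ∷ xs) = cong suc (length-flipLast (y ∷ xs))

parity-tails-not : ∀ x xs → parity (tails (not x ∷ xs)) ≡ parity (tails (x ∷ xs)) ⁻¹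
parity-tails-not true  xs = parity-suc (tails xs)
parity-tails-not false xs = sym (suc-homo-⁻¹ (tails xs))

parity-tails-flipLast : ∀ x xs →
  parity (tails (flipLast (x ∷ xs))) ≡ parity (tails (x ∷ xs)) ⁻¹
parity-tails-flipLast x     []       = parity-tails-not x []
parity-tails-flipLast true  (y ∷ ys) = parity-tails-flipLast y ys
parity-tails-flipLast false (y ∷ ys) = begin
  parity (suc (tails (flipLast (y ∷ ys))))  ≡⟨ parity-suc (tails (flipLast (y ∷ ys))) ⟩
  parity (tails (flipLast (y ∷ ys))) ⁻¹     ≡⟨ cong _⁻¹ (parity-tails-flipLast y ys) ⟩
  parity (tails (y ∷ ys)) ⁻¹ ⁻¹             ≡⟨ cong _⁻¹ (parity-suc (tails (y ∷ ys))) ⟨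
  parity (suc (tails (y ∷ ys))) ⁻¹          ∎
  where open ≡-Reasoning

parity-tails-flipNeighbours : ∀ x y xs →
  parity (tails (flipNeighbours (x ∷ y ∷ xs))) ≡ parity (tails (x ∷ y ∷ xs))
parity-tails-flipNeighbours x y xs = begin
  parity (tails (not x ∷ flipLast (y ∷ xs)))  ≡⟨ parity-tails-not x _ ⟩
  parity (tails (x ∷ flipLast (y ∷ xs))) ⁻¹   ≡⟨ cong _⁻¹ (parity-tails-flipLast x (y ∷ xs)) ⟩
  parity (tails (x ∷ y ∷ xs)) ⁻¹ ⁻¹           ≡⟨ ⁻¹-involutive _ ⟩
  parity (tails (x ∷ y ∷ xs))                 ∎
  where open ≡-Reasoning

heads-before-tails : ∀ xs → false ∈ xs →
  ∃₂ λ ys zs → true ∷ xs ≡ ys ++ true ∷ false ∷ zs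
heads-before-tails (false ∷ xs) _         = [] , xs , refl
heads-before-tails (true  ∷ xs) (there f) with ys , zs , eq ← heads-before-tails xs f
  = true ∷ ys , zs , cong (true ∷_) eq

removable-rotate : ∀ xs ys → Removable (ys ++ xs) → Removable (xs ++ ys)
removable-rotate []       ys r = subst Removable (++-identityʳ ys) r
removable-rotate (x ∷ xs) ys r = rotate
  (subst Removable (sym (++-assoc xs ys [ x ]))
    (removable-rotate xs (ys ++ [ x ])
      (subst Removable (sym (++-assoc ys [ x ] xs)) r)))

removable-[x]⇒x≡true : ∀ {x} → Removable [ x ] → x ≡ true
removable-[x]⇒x≡true (rotate r) = removable-[x]⇒x≡true r
removable-[x]⇒x≡true (move _)   = refl

removable⇒true∈ : ∀ {x xs} → Removable (x ∷ xs) → true ∈ x ∷ xs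
removable⇒true∈                 (move _)   = here refl
removable⇒true∈ {xs = []}       (rotate r) = removable⇒true∈ r
removable⇒true∈ {x} {xs@(_ ∷ _)} (rotate r) = ∈-resp-↭ (++-comm xs [ x ]) (removable⇒true∈ r)

-- The bound excludes [ true ], which one move removes without flipping anything.
removable⇒odd-tails : ∀ {c} → Removable c → 2 ≤ length c → parity (tails c) ≡ 1ℙ
removable⇒odd-tails (rotate {x} {xs} r) 2≤len =
  trans (cong parity (tails-++-comm [ x ] xs))
        (removable⇒odd-tails r (subst (2 ≤_) (length-++-comm [ x ] xs) 2≤len))
removable⇒odd-tails (move {[]} _) (s≤s ())
removable⇒odd-tails (move {false ∷ []} _) _ = refl
removable⇒odd-tails (move {true ∷ []} r) _ with () ← removable-[x]⇒x≡true r
removable⇒odd-tails (move {x ∷ y ∷ xs} r) _ =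
  trans (sym (parity-tails-flipNeighbours x y xs))
        (removable⇒odd-tails r (s≤s (subst (1 ≤_) (sym (length-flipLast (y ∷ xs))) (s≤s z≤n))))

mutual
  removable-true∷ : ∀ n xs → length xs ≡ n → parity (tails xs) ≡ 1ℙ → Removable (true ∷ xs)
  removable-true∷ zero    []      _  ()
  removable-true∷ zero    (_ ∷ _) () _
  removable-true∷ (suc n) xs      len odd
    with ys , zs , eq ← heads-before-tails xs (odd-tails⇒false∈ xs odd)
    = subst Removable (sym eq)
        (removable-rotate ys (true ∷ false ∷ zs)
          (removable-true∷false∷ n (zs ++ ys)
            (suc-injective (suc-injective rotated-length))
            (trans (cong parity rotated-tails) odd)))
    where
    open ≡-Reasoning
    rotated-length : length (true ∷ false ∷ zs ++ ys) ≡ suc (suc n)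
    rotated-length = begin
      length ((true ∷ false ∷ zs) ++ ys)  ≡⟨ length-++-comm (true ∷ false ∷ zs) ys ⟩
      length (ys ++ true ∷ false ∷ zs)    ≡⟨ cong length eq ⟨
      length (true ∷ xs)                  ≡⟨ cong suc len ⟩
      suc (suc n)                         ∎
    rotated-tails : tails (false ∷ zs ++ ys) ≡ tails xs
    rotated-tails = begin
      tails ((true ∷ false ∷ zs) ++ ys)  ≡⟨ tails-++-comm (true ∷ false ∷ zs) ys ⟩
      tails (ys ++ true ∷ false ∷ zs)    ≡⟨ cong tails eq ⟨
      tails (true ∷ xs)                  ∎

  removable-true∷false∷ : ∀ n xs → length xs ≡ n → parity (tails (false ∷ xs)) ≡ 1ℙ →
                          Removable (true ∷ false ∷ xs)
  removable-true∷false∷ n []       _   _   = move (move done)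
  removable-true∷false∷ n (x ∷ xs) len odd = move
    (removable-true∷ n (flipLast (x ∷ xs))
      (trans (length-flipLast (x ∷ xs)) len)
      (trans (parity-tails-flipNeighbours false x xs) odd))

true∈∧odd-tails⇒removable : ∀ {c} → true ∈ c → parity (tails c) ≡ 1ℙ → Removable c
true∈∧odd-tails⇒removable true∈c odd with ys , zs , refl ← ∈-∃++ true∈c =
  removable-rotate ys (true ∷ zs)
    (removable-true∷ _ (zs ++ ys) refl (trans (cong parity (tails-++-comm (true ∷ zs) ys)) odd))

proposition5 : (c : Coins) → 2 ≤ length c →
    Removable c ⇔ ((true ∈ c) × (tails c % 2 ≡ 1))
proposition5 []      ()
proposition5 c@(_ ∷ _) 2≤len = mk⇔
  (λ r → removable⇒true∈ r , parity≡1ℙ⇒%2≡1 (tails c) (removable⇒odd-tails r 2≤len))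
  (λ (true∈c , odd) → true∈∧odd-tails⇒removable true∈c (%2≡1⇒parity≡1ℙ (tails c) odd))
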